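{- Let $G$ be a connected hypergraph with $m$ edges. The following are equivalent. (1) $G$ is minimal non-odd-transversal. (2) $m$ is odd, $\sum_{e \in E(G)}\chi_e=0$ over $\mathbb{Z}_2$, and $\sum_{e \in F} \chi_e \neq 0$ over $\mathbb{Z}_2$ for every nonempty proper subset $F$ of $E(G)$. (3) $m$ is odd, $\sum_{e \in E(G)}\chi_e=0$ over $\mathbb{Z}_2$, and $\operatorname{rank} B_G=m-1$ over $\mathbb{Z}_2$. (4) $m$ is odd, each vertex of $G$ has even degree, and every nonempty proper edge-induced sub-hypergraph of $G$ contains a vertex of odd degree (degree taken in that sub-hypergraph).
   Context: A hypergraph $G=(V,E)$ has a finite vertex set $V$ and an edge set $E$ consisting of distinct nonempty subsets of $V$ (no multiple edges), and no isolated vertices (every vertex lies in some edge). The degree of a vertex is the number of edges containing it. $G$ is connected if any two vertices are joined by a walk $v_0e_1v_1\dots e_tv_t$ with $\{v_{i-1},v_i\}\subseteq e_i$. A subset $U\subseteq V$ is an odd transversal if every edge meets $U$ in an odd number of vertices; $G$ is odd-transversal if it has an odd transversal. $G$ is minimal non-odd-transversal if it is not odd-transversal but $G-e$ (delete the edge $e$ from $E(G)$) is odd-transversal for every edge $e$. For $F\subseteq E(G)$, the edge-induced sub-hypergraph $G|_F$ has vertex set $\bigcup_{e\in F}e$ and edge set $F$. For an edge $e$, $\chi_e\in\mathbb{Z}_2^{V(G)}$ is its indicator vector ($\chi_e(v)=1$ iff $v\in e$). The incidence matrix $B_G$ is the $|E(G)|\times|V(G)|$ matrix with rows $\chi_e$,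 $e\in E(G)$, viewed over $\mathbb{Z}_2$. -}

module Defs where

open import Data.Bool using (not; Bool; true; false; _xor_; _∧_; if_then_else_)
open import Data.Nat using (ℕ; zero; suc; _%_; _≤_; _∸_)
open import Data.Fin using (Fin; zero; suc; _≟_)
open import Relation.Nullary using (¬_; isYes)
open import Data.Fin.Subset using (Subset; _∈_; _∉_; _∩_; ∣_∣; Nonempty; Empty; ⊤; _⊆_)
open import Data.Vec using (Vec; []; _∷_; replicate; zipWith; lookup; tabulate)
open import Data.Product using (Σ; ∃; _×_; _,_)
open import Relation.Binary.PropositionalEquality using (_≡_; _≢_)
open import Function.Definitions using (Injective)

-- Vectors over Z₂ are Vec Bool n (true = 1); addition is pointwise xor.
zeroVec : ∀ {n} → Vec Bool n
zeroVec {n} = replicate n false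

_⊕_ : ∀ {n} → Vec Bool n → Vec Bool n → Vec Bool n
_⊕_ = zipWith _xor_

sumRows : ∀ {m n} → (Fin m → Vec Bool n) → Subset m → Vec Bool n
sumRows {zero}  r []      = zeroVec
sumRows {suc m} r (b ∷ F) =
  (if b then r zero else zeroVec) ⊕ sumRows (λ j → r (suc j)) F

Odd : ℕ → Set
Odd k = k % 2 ≡ 1

Even : ℕ → Set
Even k = k % 2 ≡ 0

record Hypergraph (n m : ℕ) : Set where
  field
    edge       : Fin m → Subset n
    distinct   : Injective _≡_ _≡_ edge
    nonempty   : ∀ i → Nonempty (edge i)
    noIsolated : ∀ v → ∃ λ i → v ∈ edge i
open Hypergraph public

data Reach {n m} (G : Hypergraph n m) (u : Fin n) : Fin n → Set where
  here : Reach G u u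
  step : ∀ {w v} (i : Fin m) → Reach G u w → w ∈ edge G i → v ∈ edge G i →
         Reach G u v

Connected : ∀ {n m} → Hypergraph n m → Set
Connected G = ∀ u v → Reach G u v

-- The sub-hypergraph consisting of the edges in F is odd-transversal:
-- some U meets every edge of F in an odd number of vertices.
-- (A subset of V(G) restricts to a subset of V(G|_F) with the same
-- intersections with edges of F, and conversely.)
OddTransversalOn : ∀ {n m} → Hypergraph n m → Subset m → Set
OddTransversalOn {n} G F =
  ∃ λ (U : Subset n) → ∀ i → i ∈ F → Odd ∣ edge G i ∩ U ∣

OddTransversal : ∀ {n m} → Hypergraph n m → Set
OddTransversal G = OddTransversalOn G ⊤

allBut : ∀ {m} → Fin m → Subset m
allBut i = tabulate (λ j → not (isYes (j ≟ i)))

MinimalNonOddTransversal : ∀ {n m} → Hypergraph n m → Set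
MinimalNonOddTransversal G =
  ¬ OddTransversal G × (∀ i → OddTransversalOn G (allBut i))

B : ∀ {n m} → Hypergraph n m → Fin m → Vec Bool n
B G = edge G

χsum : ∀ {n m} → Hypergraph n m → Subset m → Vec Bool n
χsum G F = sumRows (B G) F

NonemptyProper : ∀ {m} → Subset m → Set
NonemptyProper F = Nonempty F × (∃ λ j → j ∉ F)

-- rank over Z₂ of the matrix with rows r : the maximum size of a linearly
-- independent set of rows.  A set S of rows is linearly independent iff no
-- nonempty subset T ⊆ S sums to zero.
LinIndep : ∀ {m n} → (Fin m → Vec Bool n) → Subset m → Set
LinIndep r S = ∀ T → T ⊆ S → sumRows r T ≡ zeroVec → Empty T

HasRank : ∀ {m n} → (Fin m → Vec Bool n) → ℕ → Set
HasRank r k = (∃ λ S → LinIndep r S × ∣ S ∣ ≡ k) ×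
              (∀ S → LinIndep r S → ∣ S ∣ ≤ k)

degIn : ∀ {n m} → Hypergraph n m → Subset m → Fin n → ℕ
degIn G F v = ∣ tabulate (λ j → lookup F j ∧ lookup (edge G j) v) ∣

InVertexSetOf : ∀ {n m} → Hypergraph n m → Subset m → Fin n → Set
InVertexSetOf G F v = ∃ λ j → j ∈ F × v ∈ edge G j

Cond2 : ∀ {n m} → Hypergraph n m → Set
Cond2 {n} {m} G = Odd m × χsum G ⊤ ≡ zeroVec ×
  (∀ F → NonemptyProper F → χsum G F ≢ zeroVec)

Cond3 : ∀ {n m} → Hypergraph n m → Set
Cond3 {n} {m} G = Odd m × χsum G ⊤ ≡ zeroVec × HasRank (B G) (m ∸ 1)

Cond4 : ∀ {n m} → Hypergraph n m → Set
Cond4 {n} {m} G = Odd m × (∀ v → Even (degIn G ⊤ v)) ×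
  (∀ F → NonemptyProper F →
     ∃ λ v → InVertexSetOf G F v × Odd (degIn G F v))

-- Over ℤ₂, an odd transversal of the edges F is a solution U of the system χₑ · U = 1
-- (e ∈ F), and by the Fredholm alternative no solution exists iff some T ⊆ F of odd
-- size has Σ_{e ∈ T} χₑ = 0.  Minimality says that E(G) itself is the only such odd
-- dependency, and since the complement of an even dependency is then an odd one, that no
-- nonempty proper family of edges is dependent at all: the rows of B_G form a circuit,
-- which is (2).  A circuit of m vectors is a dependent family of rank m − 1, giving (3),
-- and the coordinates of Σ_{e ∈ F} χₑ are the degree parities in G|_F, giving (4).
module Submission where

open import Defs
open import Algebra.Bundles using (CommutativeRing)
open import Data.Bool using (Bool; true; false; not; _xor_; _∧_; if_then_else_)
open import Data.Bool.Properties
  using (xor-∧-commutativeRing; ∧-identityʳ; ∧-zeroʳ; ∧-distribʳ-xor; ¬-not)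
import Data.Bool.Properties as Bool
open import Data.Empty using (⊥-elim)
open import Data.Fin using (Fin; zero; suc; _≟_)
open import Data.Fin.Properties using (any?)
open import Data.Fin.Subset
  using (Subset; _∈_; _∉_; _∩_; ∣_∣; Nonempty; ⊤; ⊥; _⊆_; ∁; ⁅_⁆)
open import Data.Fin.Subset.Properties
  using (_∈?_; nonempty?; ∈⊤; ⊆⊤; ⊆-refl; ⊆-trans; ⊆-antisym; p⊆q⇒∣p∣≤∣q∣; p⊂q⇒∣p∣<∣q∣;
         ∣⊤∣≡n; ∣∁p∣≡n∸∣p∣; ∣⁅x⁆∣≡1; x∈⁅x⁆; x∈⁅y⁆⇒x≡y; x≢y⇒x∉⁅y⁆;
         x∈p⇒x∉∁p; x∈∁p⇒x∉p; x∉∁p⇒x∈p; x∉p⇒x∈∁p)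
open import Data.Nat using (zero; suc; _+_; _%_; _≤_; _∸_)
open import Data.Nat.DivMod using (%-distribˡ-+)
open import Data.Nat.Properties using (0≢1+n; 1+n≢0; ≤-trans; ≤-reflexive; <⇒≱)
open import Data.Product using (_×_; _,_; ∃; map; map₁; map₂)
open import Data.Sum using (_⊎_; inj₁; inj₂)
open import Data.Vec using (Vec; []; _∷_; head; tail; lookup; tabulate; here; there)
open import Data.Vec.Properties
  using (lookup-zipWith; lookup-replicate; tabulate∘lookup; tabulate-cong; zipWith-replicate;
         []=⇒lookup; lookup⇒[]=)
open import Function using (_∘_)
open import Function.Bundles using (_⇔_; mk⇔; Equivalence)
open import Relation.Nullary using (¬_; yes; no; isYes; contradiction)
open import Relation.Nullary.Decidable using (_×-dec_)
open import Relation.Binary.PropositionalEquality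
open import Algebra.Properties.CommutativeSemigroup
  (CommutativeRing.+-commutativeSemigroup xor-∧-commutativeRing)
  using () renaming (interchange to xor-interchange)

open Equivalence using (to; from)
open import Function.Properties.Equivalence using () renaming (trans to ⇔-trans)

sumBits : ∀ {m} → (Fin m → Bool) → Subset m → Bool
sumBits f []      = false
sumBits f (b ∷ S) = (b ∧ f zero) xor sumBits (f ∘ suc) S

sumBits-cong : ∀ {m} {f g : Fin m → Bool} (S : Subset m) →
               (∀ {i} → i ∈ S → f i ≡ g i) → sumBits f S ≡ sumBits g S
sumBits-cong []          f≡g = refl
sumBits-cong (true ∷ S)  f≡g = cong₂ _xor_ (f≡g here) (sumBits-cong S (f≡g ∘ there))
sumBits-cong (false ∷ S) f≡g = sumBits-cong S (f≡g ∘ there)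

sumBits-xor : ∀ {m} (f g : Fin m → Bool) S →
              sumBits (λ i → f i xor g i) S ≡ sumBits f S xor sumBits g S
sumBits-xor f g []          = refl
sumBits-xor f g (true ∷ S)  =
  trans (cong ((f zero xor g zero) xor_) (sumBits-xor (f ∘ suc) (g ∘ suc) S))
        (xor-interchange (f zero) (g zero) (sumBits (f ∘ suc) S) (sumBits (g ∘ suc) S))
sumBits-xor f g (false ∷ S) = sumBits-xor (f ∘ suc) (g ∘ suc) S

sumBits-xor≡true : ∀ {m} (f g : Fin m → Bool) S →
                   sumBits (λ i → f i xor g i) S ≡ true → sumBits g S ≡ not (sumBits f S)
sumBits-xor≡true f g S odd = xor≡true⇒≡not (trans (sym (sumBits-xor f g S)) odd)
  where
  xor≡true⇒≡not : ∀ {a b} → a xor b ≡ true → b ≡ not a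
  xor≡true⇒≡not {true}  {false} _ = refl
  xor≡true⇒≡not {false} {true}  _ = refl

sumBits-⊕ : ∀ {m} (f : Fin m → Bool) S T → sumBits f (S ⊕ T) ≡ sumBits f S xor sumBits f T
sumBits-⊕ f []      []      = refl
sumBits-⊕ f (a ∷ S) (b ∷ T) =
  trans (cong₂ _xor_ (∧-distribʳ-xor (f zero) a b) (sumBits-⊕ (f ∘ suc) S T))
        (xor-interchange (a ∧ f zero) (b ∧ f zero) (sumBits (f ∘ suc) S) (sumBits (f ∘ suc) T))

sumBits-⊥ : ∀ {m} (f : Fin m → Bool) → sumBits f ⊥ ≡ false
sumBits-⊥ {zero}  f = refl
sumBits-⊥ {suc m} f = sumBits-⊥ (f ∘ suc)

sumBits-⁅⁆ : ∀ {m} (f : Fin m → Bool) i → sumBits f ⁅ i ⁆ ≡ f i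
sumBits-⁅⁆ f zero    = trans (cong (f zero xor_) (sumBits-⊥ (f ∘ suc))) (Bool.xor-identityʳ _)
sumBits-⁅⁆ f (suc i) = sumBits-⁅⁆ (f ∘ suc) i

sumBits-true⇒∃ : ∀ {m} (f : Fin m → Bool) S → sumBits f S ≡ true → ∃ λ i → i ∈ S × f i ≡ true
sumBits-true⇒∃ f (true ∷ S) sum≡true with f zero in f₀
... | true  = zero , here , f₀
... | false = map suc (map₁ there) (sumBits-true⇒∃ (f ∘ suc) S sum≡true)
sumBits-true⇒∃ f (false ∷ S) sum≡true = map suc (map₁ there) (sumBits-true⇒∃ (f ∘ suc) S sum≡true)

⊤-or-∉ : ∀ {m} (p : Subset m) → p ≡ ⊤ ⊎ ∃ λ j → j ∉ p
⊤-or-∉ p with nonempty? (∁ p)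
... | yes (j , j∈∁p) = inj₂ (j , x∈∁p⇒x∉p j∈∁p)
... | no ∁p-empty    = inj₁ (⊆-antisym ⊆⊤ λ {x} _ → x∉∁p⇒x∈p λ x∈∁p → ∁p-empty (x , x∈∁p))

p≡⊤⇒x∈p : ∀ {m} {x : Fin m} {p} → p ≡ ⊤ → x ∈ p
p≡⊤⇒x∈p refl = ∈⊤

x∉p⇒p⊆∁⁅x⁆ : ∀ {m} {x : Fin m} {p} → x ∉ p → p ⊆ ∁ ⁅ x ⁆
x∉p⇒p⊆∁⁅x⁆ x∉p y∈p = x∉p⇒x∈∁p (x≢y⇒x∉⁅y⁆ λ { refl → x∉p y∈p })

∣∁⁅x⁆∣≡n∸1 : ∀ {m} (x : Fin m) → ∣ ∁ ⁅ x ⁆ ∣ ≡ m ∸ 1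
∣∁⁅x⁆∣≡n∸1 {m} x = trans (∣∁p∣≡n∸∣p∣ ⁅ x ⁆) (cong (m ∸_) (∣⁅x⁆∣≡1 x))

p⊆q∧∣q∣≤∣p∣⇒q⊆p : ∀ {m} {p q : Subset m} → p ⊆ q → ∣ q ∣ ≤ ∣ p ∣ → q ⊆ p
p⊆q∧∣q∣≤∣p∣⇒q⊆p {p = p} p⊆q ∣q∣≤∣p∣ {x} x∈q with x ∈? p
... | yes x∈p = x∈p
... | no  x∉p = contradiction ∣q∣≤∣p∣ (<⇒≱ (p⊂q⇒∣p∣<∣q∣ (p⊆q , x , x∈q , x∉p)))

allBut≡∁⁅⁆ : ∀ {m} (i : Fin m) → allBut i ≡ ∁ ⁅ i ⁆
allBut≡∁⁅⁆ zero    = cong (false ∷_) (tabulate-true≡∁⊥)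
  where
  tabulate-true≡∁⊥ : ∀ {m} → tabulate {n = m} (λ _ → true) ≡ ∁ ⊥
  tabulate-true≡∁⊥ {zero}  = refl
  tabulate-true≡∁⊥ {suc m} = cong (true ∷_) tabulate-true≡∁⊥
allBut≡∁⁅⁆ (suc i) =
  cong (true ∷_) (trans (tabulate-cong λ x → cong not (suc-≟ x)) (allBut≡∁⁅⁆ i))
  where
  suc-≟ : ∀ x → isYes (suc x ≟ suc i) ≡ isYes (x ≟ i)
  suc-≟ x with x ≟ i
  ... | yes _ = refl
  ... | no  _ = refl

x∉p⇒p⊆allBut : ∀ {m} {x : Fin m} {p} → x ∉ p → p ⊆ allBut x
x∉p⇒p⊆allBut {x = x} x∉p = subst (_ ⊆_) (sym (allBut≡∁⁅⁆ x)) (x∉p⇒p⊆∁⁅x⁆ x∉p)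

x∉allBut : ∀ {m} (x : Fin m) → x ∉ allBut x
x∉allBut x = subst (x ∉_) (sym (allBut≡∁⁅⁆ x)) (x∈p⇒x∉∁p (x∈⁅x⁆ x))

∁≡⊤⊕ : ∀ {m} (p : Subset m) → ∁ p ≡ ⊤ ⊕ p
∁≡⊤⊕ []      = refl
∁≡⊤⊕ (b ∷ p) = cong (not b ∷_) (∁≡⊤⊕ p)

⁅⁆⊆ : ∀ {m} {i : Fin m} {M} → i ∈ M → ⁅ i ⁆ ⊆ M
⁅⁆⊆ {i = i} i∈M x∈⁅i⁆ = subst (_∈ _) (sym (x∈⁅y⁆⇒x≡y i x∈⁅i⁆)) i∈M

⊕-⊆ : ∀ {m} {S T M : Subset m} → S ⊆ M → T ⊆ M → S ⊕ T ⊆ M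
⊕-⊆ {S = S} {T} S⊆M T⊆M {x} x∈S⊕T with lookup S x in S[x]
... | true  = S⊆M (lookup⇒[]= x S S[x])
... | false = T⊆M (lookup⇒[]= x T (begin
  lookup T x                    ≡⟨ cong (_xor lookup T x) (sym S[x]) ⟩
  lookup S x xor lookup T x     ≡⟨ sym (lookup-zipWith _xor_ x S T) ⟩
  lookup (S ⊕ T) x              ≡⟨ []=⇒lookup x∈S⊕T ⟩
  true                          ∎))
  where open ≡-Reasoning

parity : ∀ {m} → Subset m → Bool
parity = sumBits (λ _ → true)

∣p∣%2 : ∀ {m} (p : Subset m) → ∣ p ∣ % 2 ≡ (if parity p then 1 else 0)
∣p∣%2 []          = refl
∣p∣%2 (false ∷ p) = ∣p∣%2 p
∣p∣%2 (true ∷ p)  = begin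
  (1 + ∣ p ∣) % 2                           ≡⟨ %-distribˡ-+ 1 ∣ p ∣ 2 ⟩
  (1 + ∣ p ∣ % 2) % 2                       ≡⟨ cong (λ k → (1 + k) % 2) (∣p∣%2 p) ⟩
  (1 + (if parity p then 1 else 0)) % 2     ≡⟨ flip (parity p) ⟩
  (if not (parity p) then 1 else 0)         ∎
  where
  open ≡-Reasoning
  flip : ∀ b → (1 + (if b then 1 else 0)) % 2 ≡ (if not b then 1 else 0)
  flip true  = refl
  flip false = refl

odd⇔parity : ∀ {m} (p : Subset m) → Odd ∣ p ∣ ⇔ parity p ≡ true
odd⇔parity p with parity p | ∣p∣%2 p
... | true  | %2≡1 = mk⇔ (λ _ → refl) (λ _ → %2≡1)
... | false | %2≡0 = mk⇔ (λ %2≡1 → contradiction (trans (sym %2≡0) %2≡1) 0≢1+n) (λ ())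

even⇔parity : ∀ {m} (p : Subset m) → Even ∣ p ∣ ⇔ parity p ≡ false
even⇔parity p with parity p | ∣p∣%2 p
... | false | %2≡0 = mk⇔ (λ _ → refl) (λ _ → %2≡0)
... | true  | %2≡1 = mk⇔ (λ %2≡0 → contradiction (trans (sym %2≡1) %2≡0) 1+n≢0) (λ ())

odd⇔parity⊤ : ∀ {m} → Odd m ⇔ parity (⊤ {m}) ≡ true
odd⇔parity⊤ {m} = subst (λ k → Odd k ⇔ parity (⊤ {m}) ≡ true) (∣⊤∣≡n m) (odd⇔parity (⊤ {m}))

parity-true⇒nonempty : ∀ {m} (p : Subset m) → parity p ≡ true → Nonempty p
parity-true⇒nonempty p odd with sumBits-true⇒∃ _ p odd
... | i , i∈p , _ = i , i∈p

parity-∁ : ∀ {m} (p : Subset m) → parity (∁ p) ≡ parity (⊤ {m}) xor parity p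
parity-∁ {m} p = trans (cong parity (∁≡⊤⊕ p)) (sumBits-⊕ _ (⊤ {m}) p)

Dependent : ∀ {m n} → (Fin m → Vec Bool n) → Subset m → Set
Dependent r T = sumRows r T ≡ zeroVec

_·_ : ∀ {n} → Vec Bool n → Vec Bool n → Bool
x · u = sumBits (lookup u) x

parity-∩ : ∀ {n} (x u : Vec Bool n) → parity (x ∩ u) ≡ x · u
parity-∩ []      []      = refl
parity-∩ (a ∷ x) (b ∷ u) = cong₂ _xor_ (∧-identityʳ (a ∧ b)) (parity-∩ x u)

·-∷ : ∀ {n} (x : Vec Bool (suc n)) b u → x · (b ∷ u) ≡ (head x ∧ b) xor (tail x · u)
·-∷ (a ∷ x) b u = refl

vec₀ : (x : Vec Bool zero) → x ≡ []
vec₀ [] = refl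

lookup-ext : ∀ {n} {x y : Vec Bool n} → (∀ v → lookup x v ≡ lookup y v) → x ≡ y
lookup-ext {x = x} {y} x≗y =
  trans (sym (tabulate∘lookup x)) (trans (tabulate-cong x≗y) (tabulate∘lookup y))

zeroVec-or-∃true : ∀ {n} (x : Vec Bool n) → x ≡ zeroVec ⊎ ∃ λ v → lookup x v ≡ true
zeroVec-or-∃true []          = inj₁ refl
zeroVec-or-∃true (true ∷ x)  = inj₂ (zero , refl)
zeroVec-or-∃true (false ∷ x) with zeroVec-or-∃true x
... | inj₁ x≡0       = inj₁ (cong (false ∷_) x≡0)
... | inj₂ (v , x[v]) = inj₂ (suc v , x[v])

sumRows-linear : ∀ {m n} (φ : Vec Bool n → Bool) → φ zeroVec ≡ false →
                 (∀ x y → φ (x ⊕ y) ≡ φ x xor φ y) →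
                 ∀ (r : Fin m → Vec Bool n) S → φ (sumRows r S) ≡ sumBits (φ ∘ r) S
sumRows-linear φ φ0 φ⊕ r []      = φ0
sumRows-linear φ φ0 φ⊕ r (b ∷ S) = begin
  φ ((if b then r zero else zeroVec) ⊕ sumRows (r ∘ suc) S)       ≡⟨ φ⊕ _ _ ⟩
  φ (if b then r zero else zeroVec) xor φ (sumRows (r ∘ suc) S)
    ≡⟨ cong₂ _xor_ (φ-scale b) (sumRows-linear φ φ0 φ⊕ (r ∘ suc) S) ⟩
  (b ∧ φ (r zero)) xor sumBits (φ ∘ r ∘ suc) S                    ∎
  where
  open ≡-Reasoning
  φ-scale : ∀ b → φ (if b then r zero else zeroVec) ≡ b ∧ φ (r zero)
  φ-scale true  = refl
  φ-scale false = φ0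

lookup-sumRows : ∀ {m n} (r : Fin m → Vec Bool n) S v →
                 lookup (sumRows r S) v ≡ sumBits (λ i → lookup (r i) v) S
lookup-sumRows r S v =
  sumRows-linear (λ x → lookup x v) (lookup-replicate v false) (lookup-zipWith _xor_ v) r S

·-sumRows : ∀ {m n} (r : Fin m → Vec Bool n) S u → sumRows r S · u ≡ sumBits (λ i → r i · u) S
·-sumRows r S u = sumRows-linear (_· u) (sumBits-⊥ (lookup u)) (sumBits-⊕ (lookup u)) r S

sumRows-⊕ : ∀ {m n} (r : Fin m → Vec Bool n) S T → sumRows r (S ⊕ T) ≡ sumRows r S ⊕ sumRows r T
sumRows-⊕ r S T = lookup-ext λ v → begin
  lookup (sumRows r (S ⊕ T)) v                               ≡⟨ lookup-sumRows r (S ⊕ T) v ⟩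
  sumBits (λ i → lookup (r i) v) (S ⊕ T)                     ≡⟨ sumBits-⊕ _ S T ⟩
  sumBits (λ i → lookup (r i) v) S xor sumBits (λ i → lookup (r i) v) T
    ≡⟨ sym (cong₂ _xor_ (lookup-sumRows r S v) (lookup-sumRows r T v)) ⟩
  lookup (sumRows r S) v xor lookup (sumRows r T) v
    ≡⟨ sym (lookup-zipWith _xor_ v (sumRows r S) (sumRows r T)) ⟩
  lookup (sumRows r S ⊕ sumRows r T) v                       ∎
  where open ≡-Reasoning

sumRows-∷ : ∀ {m n} (r : Fin m → Vec Bool (suc n)) S →
            sumRows r S ≡ sumBits (head ∘ r) S ∷ sumRows (tail ∘ r) S
sumRows-∷ r []      = refl
sumRows-∷ r (b ∷ S) = trans (cong (_ ⊕_) (sumRows-∷ (r ∘ suc) S)) (split b (r zero))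
  where
  split : ∀ {n} b (x : Vec Bool (suc n)) {h t} →
          (if b then x else zeroVec) ⊕ (h ∷ t) ≡
          ((b ∧ head x) xor h) ∷ ((if b then tail x else zeroVec) ⊕ t)
  split true  (a ∷ x) = refl
  split false (a ∷ x) = refl

dependent-⊕ : ∀ {m n} (r : Fin m → Vec Bool n) S T →
              Dependent r S → Dependent r T → Dependent r (S ⊕ T)
dependent-⊕ r S T dS dT =
  trans (sumRows-⊕ r S T) (trans (cong₂ _⊕_ dS dT) (zipWith-replicate _xor_ false false))

dependent-∁ : ∀ {m n} (r : Fin m → Vec Bool n) T →
              Dependent r ⊤ → Dependent r T → Dependent r (∁ T)
dependent-∁ r T d⊤ dT = subst (Dependent r) (sym (∁≡⊤⊕ T)) (dependent-⊕ r ⊤ T d⊤ dT)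

dependent-∷ : ∀ {m n} (r : Fin m → Vec Bool (suc n)) T →
              sumBits (head ∘ r) T ≡ false → Dependent (tail ∘ r) T → Dependent r T
dependent-∷ r T head≡0 tail≡0 = trans (sumRows-∷ r T) (cong₂ _∷_ head≡0 tail≡0)

-- The Fredholm alternative over ℤ₂

Solves : ∀ {m n} → (Fin m → Vec Bool n) → (Fin m → Bool) → Subset m → Vec Bool n → Set
Solves r c M u = ∀ i → i ∈ M → r i · u ≡ c i

record Obstruction {m n} (r : Fin m → Vec Bool n) (c : Fin m → Bool) (M : Subset m) : Set where
  constructor obstruction
  field
    support   : Subset m
    support⊆M : support ⊆ M
    dependent : Dependent r support
    odd       : sumBits c support ≡ true

solves⇒orthogonal : ∀ {m n} {r : Fin m → Vec Bool n} {c M u T} →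
                    Solves r c M u → T ⊆ M → Dependent r T → sumBits c T ≡ false
solves⇒orthogonal {r = r} {c} {u = u} {T} sol T⊆M dep = begin
  sumBits c T                 ≡⟨ sumBits-cong T (λ i∈T → sym (sol _ (T⊆M i∈T))) ⟩
  sumBits (λ i → r i · u) T   ≡⟨ sym (·-sumRows r T u) ⟩
  sumRows r T · u             ≡⟨ cong (_· u) dep ⟩
  zeroVec · u                 ≡⟨ sumBits-⊥ (lookup u) ⟩
  false                       ∎
  where open ≡-Reasoning

solvable⇒¬obstruction : ∀ {m n} {r : Fin m → Vec Bool n} {c M} →
                        ∃ (Solves r c M) → ¬ Obstruction r c M
solvable⇒¬obstruction (u , sol) (obstruction T T⊆M dep odd)
  with trans (sym odd) (solves⇒orthogonal {u = u} sol T⊆M dep)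
... | ()

-- Of T₁, T₂ and T₁ ⊕ T₂ one has even first-column sum, so it stays dependent
-- with the first column restored; the right-hand sides were chosen to make its c-sum odd.
combine-obstructions : ∀ {m n} {r : Fin m → Vec Bool (suc n)} {c M} →
                       Obstruction (tail ∘ r) c M →
                       Obstruction (tail ∘ r) (λ i → head (r i) xor c i) M →
                       Obstruction r c M
combine-obstructions {r = r} {c} (obstruction T₁ T₁⊆M dep₁ odd₁) (obstruction T₂ T₂⊆M dep₂ odd₂)
  with sumBits (head ∘ r) T₁ in h₁ | sumBits (head ∘ r) T₂ in h₂
... | false | _     = obstruction T₁ T₁⊆M (dependent-∷ r T₁ h₁ dep₁) odd₁
... | true  | false = obstruction T₂ T₂⊆M (dependent-∷ r T₂ h₂ dep₂)
  (trans (sumBits-xor≡true (head ∘ r) c T₂ odd₂) (cong not h₂))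
... | true  | true  = obstruction (T₁ ⊕ T₂) (⊕-⊆ T₁⊆M T₂⊆M)
  (dependent-∷ r (T₁ ⊕ T₂) (trans (sumBits-⊕ (head ∘ r) T₁ T₂) (cong₂ _xor_ h₁ h₂))
                 (dependent-⊕ (tail ∘ r) T₁ T₂ dep₁ dep₂))
  (trans (sumBits-⊕ c T₁ T₂)
         (cong₂ _xor_ odd₁ (trans (sumBits-xor≡true (head ∘ r) c T₂ odd₂) (cong not h₂))))

-- Induction on the number of columns: a solution for the remaining columns with
-- right-hand side c, resp. head ⊕ c, extends by the first coordinate false, resp. true.
solvable-or-obstructed : ∀ {m n} (r : Fin m → Vec Bool n) c M → ∃ (Solves r c M) ⊎ Obstruction r c M
solvable-or-obstructed {n = zero} r c M with any? (λ i → i ∈? M ×-dec c i Bool.≟ true)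
... | yes (i , i∈M , cᵢ) = inj₂ (obstruction ⁅ i ⁆ (⁅⁆⊆ i∈M) (vec₀ _) (trans (sumBits-⁅⁆ c i) cᵢ))
... | no ∄ = inj₁ ([] , λ i i∈M →
  trans (cong (_· []) (vec₀ (r i))) (sym (¬-not λ cᵢ → ∄ (i , i∈M , cᵢ))))
solvable-or-obstructed {n = suc n} r c M
  with solvable-or-obstructed (tail ∘ r) c M
     | solvable-or-obstructed (tail ∘ r) (λ i → head (r i) xor c i) M
... | inj₁ (u , sol) | _ = inj₁ (false ∷ u , λ i i∈M →
  trans (·-∷ (r i) false u) (cong₂ _xor_ (∧-zeroʳ (head (r i))) (sol i i∈M)))
... | inj₂ _ | inj₁ (u , sol) = inj₁ (true ∷ u , λ i i∈M → begin
  r i · (true ∷ u)                        ≡⟨ ·-∷ (r i) true u ⟩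
  (head (r i) ∧ true) xor (tail (r i) · u) ≡⟨ cong₂ _xor_ (∧-identityʳ (head (r i))) (sol i i∈M) ⟩
  head (r i) xor (head (r i) xor c i)      ≡⟨ sym (Bool.xor-assoc (head (r i)) _ _) ⟩
  (head (r i) xor head (r i)) xor c i      ≡⟨ cong (_xor c i) (Bool.xor-same (head (r i))) ⟩
  c i                                     ∎)
  where open ≡-Reasoning
... | inj₂ O₁ | inj₂ O₂ = inj₂ (combine-obstructions O₁ O₂)

-- Circuits and rank

Circuit : ∀ {m n} → (Fin m → Vec Bool n) → Set
Circuit r = Dependent r ⊤ × (∀ F → NonemptyProper F → ¬ Dependent r F)

avoiding-dependency : ∀ {m n} (r : Fin m → Vec Bool n) → Dependent r ⊤ →
                      ∀ F → NonemptyProper F → Dependent r F →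
                      ∀ i → ∃ λ T → T ⊆ ∁ ⁅ i ⁆ × Nonempty T × Dependent r T
avoiding-dependency r dep⊤ F ((k , k∈F) , (j , j∉F)) depF i with i ∈? F
... | yes i∈F = ∁ F , x∉p⇒p⊆∁⁅x⁆ (x∈p⇒x∉∁p i∈F) , (j , x∉p⇒x∈∁p j∉F) , dependent-∁ r F dep⊤ depF
... | no  i∉F = F , x∉p⇒p⊆∁⁅x⁆ i∉F , (k , k∈F) , depF

circuit⇔dependent×rank : ∀ {m n} (r : Fin (suc m) → Vec Bool n) →
                         Circuit r ⇔ (Dependent r ⊤ × HasRank r m)
circuit⇔dependent×rank {m} r = mk⇔ to′ from′
  where
  to′ : Circuit r → Dependent r ⊤ × HasRank r m
  to′ (dep⊤ , proper) = dep⊤ , (∁ ⁅ zero ⁆ , independent , ∣∁⁅x⁆∣≡n∸1 zero) , bounded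
    where
    independent : LinIndep r (∁ ⁅ zero ⁆)
    independent T T⊆ depT nonempty =
      proper T (nonempty , zero , λ zero∈T → x∈p⇒x∉∁p (x∈⁅x⁆ zero) (T⊆ zero∈T)) depT
    bounded : ∀ S → LinIndep r S → ∣ S ∣ ≤ m
    bounded S indep with ⊤-or-∉ S
    ... | inj₁ refl       = ⊥-elim (indep ⊤ ⊆-refl dep⊤ (zero , ∈⊤))
    ... | inj₂ (j , j∉S) = ≤-trans (p⊆q⇒∣p∣≤∣q∣ (x∉p⇒p⊆∁⁅x⁆ j∉S)) (≤-reflexive (∣∁⁅x⁆∣≡n∸1 j))
  from′ : Dependent r ⊤ × HasRank r m → Circuit r
  from′ (dep⊤ , (S , indep , ∣S∣≡m) , _) = dep⊤ , proper
    where
    proper : ∀ F → NonemptyProper F → ¬ Dependent r F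
    proper F np@((k , k∈F) , _) depF with ⊤-or-∉ S
    ... | inj₁ refl      = indep F ⊆⊤ depF (k , k∈F)
    ... | inj₂ (i , i∉S) =
      let T , T⊆∁⁅i⁆ , T≠∅ , depT = avoiding-dependency r dep⊤ F np depF i
          ∁⁅i⁆⊆S = p⊆q∧∣q∣≤∣p∣⇒q⊆p (x∉p⇒p⊆∁⁅x⁆ i∉S)
                                   (≤-reflexive (trans (∣∁⁅x⁆∣≡n∸1 i) (sym ∣S∣≡m)))
      in indep T (⊆-trans T⊆∁⁅i⁆ ∁⁅i⁆⊆S) depT T≠∅

parity-tabulate : ∀ {m} (S : Subset m) f → parity (tabulate (λ j → lookup S j ∧ f j)) ≡ sumBits f S
parity-tabulate []      f = refl
parity-tabulate (b ∷ S) f = cong₂ _xor_ (∧-identityʳ (b ∧ f zero)) (parity-tabulate S (f ∘ suc))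

module _ {n m} (G : Hypergraph n m) where

  incidences : Subset m → Fin n → Subset m
  incidences F v = tabulate (λ j → lookup F j ∧ lookup (edge G j) v)

  degree-parity : ∀ F v → parity (incidences F v) ≡ lookup (χsum G F) v
  degree-parity F v = trans (parity-tabulate F _) (sym (lookup-sumRows (edge G) F v))

  odd-degree⇔ : ∀ F v → Odd (degIn G F v) ⇔ lookup (χsum G F) v ≡ true
  odd-degree⇔ F v =
    subst (λ b → Odd (degIn G F v) ⇔ b ≡ true) (degree-parity F v) (odd⇔parity (incidences F v))

  even-degree⇔ : ∀ F v → Even (degIn G F v) ⇔ lookup (χsum G F) v ≡ false
  even-degree⇔ F v =
    subst (λ b → Even (degIn G F v) ⇔ b ≡ false) (degree-parity F v) (even⇔parity (incidences F v))

  allEven⇔dependent : ∀ F → (∀ v → Even (degIn G F v)) ⇔ Dependent (edge G) F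
  allEven⇔dependent F = mk⇔
    (λ even → lookup-ext λ v → trans (to (even-degree⇔ F v) (even v)) (sym (lookup-replicate v false)))
    (λ dep v → from (even-degree⇔ F v) (trans (cong (λ x → lookup x v) dep) (lookup-replicate v false)))

  oddVertex⇔independent : ∀ F →
    (∃ λ v → InVertexSetOf G F v × Odd (degIn G F v)) ⇔ (¬ Dependent (edge G) F)
  oddVertex⇔independent F = mk⇔ to′ from′
    where
    to′ : (∃ λ v → InVertexSetOf G F v × Odd (degIn G F v)) → ¬ Dependent (edge G) F
    to′ (v , _ , odd) dep with trans (sym (to (odd-degree⇔ F v) odd))
                                     (trans (cong (λ x → lookup x v) dep) (lookup-replicate v false))
    ... | ()
    from′ : ¬ Dependent (edge G) F → ∃ λ v → InVertexSetOf G F v × Odd (degIn G F v)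
    from′ indep with zeroVec-or-∃true (χsum G F)
    ... | inj₁ dep        = ⊥-elim (indep dep)
    ... | inj₂ (v , χ[v]) with sumBits-true⇒∃ _ F (trans (sym (lookup-sumRows (edge G) F v)) χ[v])
    ...   | j , j∈F , v∈eⱼ = v , (j , j∈F , lookup⇒[]= v (edge G j) v∈eⱼ) , from (odd-degree⇔ F v) χ[v]

  -- Odd transversals

  OddDependency : Subset m → Set
  OddDependency = Obstruction (edge G) (λ _ → true)

  oddTransversalOn⇔solvable : ∀ F → OddTransversalOn G F ⇔ ∃ (Solves (edge G) (λ _ → true) F)
  oddTransversalOn⇔solvable F = mk⇔
    (λ (U , odd) → U , λ i i∈F →
      trans (sym (parity-∩ (edge G i) U)) (to (odd⇔parity (edge G i ∩ U)) (odd i i∈F)))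
    (λ (U , sol) → U , λ i i∈F →
      from (odd⇔parity (edge G i ∩ U)) (trans (parity-∩ (edge G i) U) (sol i i∈F)))

  oddTransversalOn-or-oddDependency : ∀ F → OddTransversalOn G F ⊎ OddDependency F
  oddTransversalOn-or-oddDependency F with solvable-or-obstructed (edge G) (λ _ → true) F
  ... | inj₁ solvable = inj₁ (from (oddTransversalOn⇔solvable F) solvable)
  ... | inj₂ O        = inj₂ O

  oddTransversalOn⇒¬oddDependency : ∀ {F} → OddTransversalOn G F → ¬ OddDependency F
  oddTransversalOn⇒¬oddDependency {F} = solvable⇒¬obstruction ∘ to (oddTransversalOn⇔solvable F)

  oddDependency≡⊤ : (∀ i → OddTransversalOn G (allBut i)) →
                    ∀ {T} → Dependent (edge G) T → parity T ≡ true → T ≡ ⊤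
  oddDependency≡⊤ minimal {T} dep odd with ⊤-or-∉ T
  ... | inj₁ T≡⊤      = T≡⊤
  ... | inj₂ (j , j∉T) = ⊥-elim (oddTransversalOn⇒¬oddDependency (minimal j)
                                   (obstruction T (x∉p⇒p⊆allBut j∉T) dep odd))

  minimal⇒cond2 : MinimalNonOddTransversal G → Cond2 G
  minimal⇒cond2 (¬ot , minimal) with oddTransversalOn-or-oddDependency ⊤
  ... | inj₁ ot = ⊥-elim (¬ot ot)
  ... | inj₂ (obstruction T _ dep odd) with oddDependency≡⊤ minimal dep odd
  ... | refl = from (odd⇔parity⊤ {m}) odd , dep , proper
    where
    proper : ∀ F → NonemptyProper F → ¬ Dependent (edge G) F
    proper F ((k , k∈F) , (j , j∉F)) depF with parity F in parityF
    ... | true  = j∉F (p≡⊤⇒x∈p (oddDependency≡⊤ minimal depF parityF))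
    ... | false = x∈p⇒x∉∁p k∈F (p≡⊤⇒x∈p (oddDependency≡⊤ minimal (dependent-∁ (edge G) F dep depF)
                                                           (trans (parity-∁ F) (cong₂ _xor_ odd parityF))))

  cond2⇒minimal : Cond2 G → MinimalNonOddTransversal G
  cond2⇒minimal (odd , dep⊤ , proper) = ¬ot , minimal
    where
    ¬ot : ¬ OddTransversal G
    ¬ot ot = oddTransversalOn⇒¬oddDependency ot (obstruction ⊤ ⊆-refl dep⊤ (to (odd⇔parity⊤ {m}) odd))
    minimal : ∀ i → OddTransversalOn G (allBut i)
    minimal i with oddTransversalOn-or-oddDependency (allBut i)
    ... | inj₁ otᵢ = otᵢ
    ... | inj₂ (obstruction T T⊆ dep oddT) =
      ⊥-elim (proper T (parity-true⇒nonempty T oddT , i , x∉allBut i ∘ T⊆) dep)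

  minimal⇔cond2 : MinimalNonOddTransversal G ⇔ Cond2 G
  minimal⇔cond2 = mk⇔ minimal⇒cond2 cond2⇒minimal

  cond2⇔cond4 : Cond2 G ⇔ Cond4 G
  cond2⇔cond4 = mk⇔
    (map₂ λ (dep , proper) → from (allEven⇔dependent ⊤) dep ,
                             λ F np → from (oddVertex⇔independent F) (proper F np))
    (map₂ λ (even , oddVertex) → to (allEven⇔dependent ⊤) even ,
                                 λ F np → to (oddVertex⇔independent F) (oddVertex F np))

cond2⇔cond3 : ∀ {n m} (G : Hypergraph n m) → Cond2 G ⇔ Cond3 G
cond2⇔cond3 {m = zero}  G = mk⇔ (λ { (() , _) }) (λ { (() , _) })
cond2⇔cond3 {m = suc m} G =
  mk⇔ (map₂ (to (circuit⇔dependent×rank (edge G)))) (map₂ (from (circuit⇔dependent×rank (edge G))))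

theorem3p4 : ∀ {n m} (G : Hypergraph n m) → Connected G →
    (MinimalNonOddTransversal G ⇔ Cond2 G) ×
    (MinimalNonOddTransversal G ⇔ Cond3 G) ×
    (MinimalNonOddTransversal G ⇔ Cond4 G)
theorem3p4 G _ =
  minimal⇔cond2 G ,
  ⇔-trans (minimal⇔cond2 G) (cond2⇔cond3 G) ,
  ⇔-trans (minimal⇔cond2 G) (cond2⇔cond4 G)
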